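{- Let $k,\ell$ be integers with $0\le \ell<2k$. Let $F_1,\dots,F_a$ be forests and $P_1,\dots,P_b$ be pseudoforests, all on a common node set $V$ and pairwise edge-disjoint, where $a=\min\{\ell,2k-\ell\}$ and $b=(k-\ell)^+=\max\{k-\ell,0\}$. Then the multigraph on $V$ whose edge set is the union of the edge sets of $F_1,\dots,F_a,P_1,\dots,P_b$ is $(k,\ell)$-sparse.
   Context: A multigraph $G=(V,E)$ (loops and parallel edges allowed) is $(k,\ell)$-sparse if for every subset $X\subseteq V$ the number of edges of $G$ with both endpoints in $X$ is at most $\max\{k|X|-\ell,0\}$. A forest is a loop-free graph without cycles. A pseudoforest is an undirected (multi)graph in which every connected component contains at most one cycle (a loop counts as a cycle). The union is taken as a multigraph, i.e., edges of distinct parts are counted separately. -}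

module Defs where

open import Data.Nat using (ℕ; zero; suc; _+_; _*_; _∸_; _≤_)
open import Data.Bool using (Bool; true; false; _∧_; if_then_else_)
open import Data.Fin using (Fin; zero; suc; inject₁; fromℕ)
open import Data.Fin.Subset using (Subset; ∣_∣)
open import Data.Vec using (lookup)
open import Data.List using (List; []; _∷_; length)
import Data.List as L
open import Data.Product using (_×_; _,_; proj₁; proj₂; Σ; ∃)
open import Data.Sum using (_⊎_)
open import Relation.Binary.PropositionalEquality using (_≡_)
open import Relation.Nullary using (¬_)

-- A multigraph on node set Fin n: a list of edges, each an (unordered)
-- pair of endpoints stored as an ordered pair. Parallel edges and loops
-- are allowed; edges are distinguished by their position in the list.
Graph : ℕ → Set
Graph n = List (Fin n × Fin n)

spanned : ∀ {n} → Subset n → Graph n → ℕ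
spanned X [] = 0
spanned X ((u , v) ∷ es) =
  if lookup X u ∧ lookup X v then suc (spanned X es) else spanned X es

-- (k,ℓ)-sparse: for all X, i(X) ≤ max{k|X| − ℓ, 0}  (= k|X| ∸ ℓ on ℕ)
Sparse : ℕ → ℕ → ∀ {n} → Graph n → Set
Sparse k ℓ {n} G = (X : Subset n) → spanned X G ≤ k * ∣ X ∣ ∸ ℓ

edge : ∀ {n} (G : Graph n) → Fin (length G) → Fin n × Fin n
edge G i = L.lookup G i

Joins : ∀ {n} → Fin n × Fin n → Fin n → Fin n → Set
Joins (u , v) a b = (u ≡ a × v ≡ b) ⊎ (u ≡ b × v ≡ a)

-- A cycle of length suc m: distinct vertices v₀,…,v_m (closing back to v₀)
-- and distinct edges e₀,…,e_m, where e_i joins v_i and v_{i+1}.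
-- Length 1 is a loop, length 2 a pair of parallel edges.
record Cycle {n} (G : Graph n) : Set where
  field
    m      : ℕ
    vs     : Fin (suc (suc m)) → Fin n
    es     : Fin (suc m) → Fin (length G)
    closed : vs (fromℕ (suc m)) ≡ vs zero
    vs-inj : ∀ i j → vs (inject₁ i) ≡ vs (inject₁ j) → i ≡ j
    es-inj : ∀ i j → es i ≡ es j → i ≡ j
    joins  : ∀ i → Joins (edge G (es i)) (vs (inject₁ i)) (vs (suc i))

open Cycle public

InCycle : ∀ {n} {G : Graph n} → Cycle G → Fin (length G) → Set
InCycle C e = ∃ λ i → es C i ≡ e

SameCycle : ∀ {n} {G : Graph n} → Cycle G → Cycle G → Set
SameCycle {G = G} C D = (e : Fin (length G)) → (InCycle C e → InCycle D e) × (InCycle D e → InCycle C e)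

data Reach {n} (G : Graph n) : Fin n → Fin n → Set where
  here : ∀ {u} → Reach G u u
  step : ∀ {u v w} (e : Fin (length G)) → Joins (edge G e) u v → Reach G v w → Reach G u w

-- forest: loop-free and acyclic (a loop is a cycle of length 1)
Forest : ∀ {n} → Graph n → Set
Forest G = ¬ Cycle G

Pseudoforest : ∀ {n} → Graph n → Set
Pseudoforest G = (C D : Cycle G) → Reach G (vs C zero) (vs D zero) → SameCycle C D

{-# OPTIONS --safe #-}
module Submission where

-- A forest spans at most |X| − 1 edges inside a nonempty vertex set X and a pseudoforest
-- at most |X|, and a (|X| − 1) + b |X| ≤ k |X| − ℓ for the given a and b.
-- For the pseudoforest bound take X minimal with more than |X| inside edges. Every vertex
-- of X then has two X-edges (otherwise delete it), so a non-backtracking walk in X closes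
-- a cycle C. Either the X-edges meeting C are exactly the edges of C, and deleting the
-- vertices of C leaves a smaller such set, or another X-edge leaves C, and walking out
-- along it closes a second cycle in the component of C. The forest bound follows because
-- a forest with one loop added is a pseudoforest.

open import Defs
open import Data.Bool using (true; false; _∧_)
open import Data.Bool.Properties using (∧-conicalˡ; ∧-conicalʳ)
open import Data.Empty using (⊥; ⊥-elim)
open import Data.Fin using (Fin; zero; suc; toℕ; inject₁; fromℕ<; punchOut)
import Data.Fin.Properties as Fin
open import Data.Fin.Subset
  using (Subset; ∣_∣; _∈_; _∉_; _∩_; _∪_; _─_; ⁅_⁆; Nonempty; inside; outside)
  renaming (⊥ to ∅)
open import Data.Fin.Subset.Properties
  using ( _∈?_; nonempty?; ∉⊥; ∣⊥∣≡0; ∣⁅x⁆∣≡1; ∣p∣≤∣x∷p∣; x∈⁅x⁆; x∈⁅y⁆⇒x≡y; ∪-identityˡ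
        ; x∈p∪q⁺; x∈p∪q⁻; x∈p∩q⁺; x∈p∧x∉q⇒x∈p─q; p⊆q⇒∣p∣≤∣q∣; p∩q≢∅⇒∣p─q∣<∣p∣ )
open import Data.List using (List; []; _∷_; length; concat; _++_)
open import Data.List.Relation.Unary.All as All using (All; []; _∷_)
open import Data.Nat using (ℕ; zero; suc; _+_; _*_; _∸_; _⊓_; _≤_; _<_; _≤?_; z≤n; s≤s; s≤s⁻¹)
open import Data.Nat.Induction using (<-wellFounded)
open import Data.Nat.Properties
open import Data.Nat.Tactic.RingSolver using (solve-∀)
open import Data.Product using (_×_; _,_; proj₁; proj₂; ∃; ∃₂)
open import Data.Sum using (_⊎_; inj₁; inj₂; [_,_]′)
open import Data.Vec using ([]; _∷_; lookup; here; there)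
open import Data.Vec.Properties using ([]=⇒lookup; lookup⇒[]=)
open import Function using (_∘_; _∘′_; id)
open import Function.Definitions using (Injective)
open import Induction.WellFounded using (Acc; acc)
open import Relation.Binary.Definitions using (tri<; tri≈; tri>)
open import Relation.Binary.PropositionalEquality
open import Relation.Nullary using (Dec; yes; no; ¬_; ¬?)
open import Relation.Nullary.Decidable using (_×-dec_; _⊎-dec_; decidable-stable)

private variable
  n : ℕ
  G : Graph n

∣p∣≡∣p─q∣+∣p∩q∣ : (p q : Subset n) → ∣ p ∣ ≡ ∣ p ─ q ∣ + ∣ p ∩ q ∣
∣p∣≡∣p─q∣+∣p∩q∣ [] [] = refl
∣p∣≡∣p─q∣+∣p∩q∣ (inside ∷ p) (inside ∷ q) = trans (cong suc (∣p∣≡∣p─q∣+∣p∩q∣ p q)) (sym (+-suc _ _))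
∣p∣≡∣p─q∣+∣p∩q∣ (inside ∷ p) (outside ∷ q) = cong suc (∣p∣≡∣p─q∣+∣p∩q∣ p q)
∣p∣≡∣p─q∣+∣p∩q∣ (outside ∷ p) (inside ∷ q) = ∣p∣≡∣p─q∣+∣p∩q∣ p q
∣p∣≡∣p─q∣+∣p∩q∣ (outside ∷ p) (outside ∷ q) = ∣p∣≡∣p─q∣+∣p∩q∣ p q

∣p∪q∣≤∣p∣+∣q∣ : (p q : Subset n) → ∣ p ∪ q ∣ ≤ ∣ p ∣ + ∣ q ∣
∣p∪q∣≤∣p∣+∣q∣ [] [] = z≤n
∣p∪q∣≤∣p∣+∣q∣ (inside ∷ p) (t ∷ q) = s≤s (≤-trans (∣p∪q∣≤∣p∣+∣q∣ p q) (+-monoʳ-≤ ∣ p ∣ (∣p∣≤∣x∷p∣ t q)))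
∣p∪q∣≤∣p∣+∣q∣ (outside ∷ p) (inside ∷ q) = ≤-trans (s≤s (∣p∪q∣≤∣p∣+∣q∣ p q)) (≤-reflexive (sym (+-suc _ _)))
∣p∪q∣≤∣p∣+∣q∣ (outside ∷ p) (outside ∷ q) = ∣p∪q∣≤∣p∣+∣q∣ p q

x∉p⇒∣⁅x⁆∪p∣≡1+∣p∣ : {x : Fin n} (p : Subset n) → x ∉ p → ∣ ⁅ x ⁆ ∪ p ∣ ≡ suc ∣ p ∣
x∉p⇒∣⁅x⁆∪p∣≡1+∣p∣ {x = zero} (inside ∷ p) x∉p = ⊥-elim (x∉p here)
x∉p⇒∣⁅x⁆∪p∣≡1+∣p∣ {x = zero} (outside ∷ p) _ = cong (suc ∘ ∣_∣) (∪-identityˡ p)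
x∉p⇒∣⁅x⁆∪p∣≡1+∣p∣ {x = suc x} (inside ∷ p) x∉p = cong suc (x∉p⇒∣⁅x⁆∪p∣≡1+∣p∣ p (x∉p ∘ there))
x∉p⇒∣⁅x⁆∪p∣≡1+∣p∣ {x = suc x} (outside ∷ p) x∉p = x∉p⇒∣⁅x⁆∪p∣≡1+∣p∣ p (x∉p ∘ there)

x∈p⇒0<∣p∣ : {x : Fin n} {p : Subset n} → x ∈ p → 0 < ∣ p ∣
x∈p⇒0<∣p∣ {x = x} {p} x∈p = subst (_≤ ∣ p ∣) (∣⁅x⁆∣≡1 x)
  (p⊆q⇒∣p∣≤∣q∣ (λ y∈⁅x⁆ → subst (_∈ p) (sym (x∈⁅y⁆⇒x≡y x y∈⁅x⁆)) x∈p))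

0<∣p∣⇒nonempty : (p : Subset n) → 0 < ∣ p ∣ → Nonempty p
0<∣p∣⇒nonempty (inside ∷ p) _ = zero , here
0<∣p∣⇒nonempty (outside ∷ p) 0<∣p∣ with 0<∣p∣⇒nonempty p 0<∣p∣
... | x , x∈p = suc x , there x∈p

image : {L : ℕ} → (Fin L → Fin n) → Subset n
image {L = zero} f = ∅
image {L = suc L} f = ⁅ f zero ⁆ ∪ image (f ∘ suc)

∈-image⁺ : {L : ℕ} (f : Fin L → Fin n) (i : Fin L) → f i ∈ image f
∈-image⁺ f zero = x∈p∪q⁺ (inj₁ (x∈⁅x⁆ (f zero)))
∈-image⁺ f (suc i) = x∈p∪q⁺ (inj₂ (∈-image⁺ (f ∘ suc) i))

∈-image⁻ : {L : ℕ} (f : Fin L → Fin n) {x : Fin n} → x ∈ image f → ∃ λ i → f i ≡ x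
∈-image⁻ {L = zero} f x∈∅ = ⊥-elim (∉⊥ x∈∅)
∈-image⁻ {L = suc L} f x∈img with x∈p∪q⁻ ⁅ f zero ⁆ (image (f ∘ suc)) x∈img
... | inj₁ x∈⁅f0⁆ = zero , sym (x∈⁅y⁆⇒x≡y _ x∈⁅f0⁆)
... | inj₂ x∈rest with ∈-image⁻ (f ∘ suc) x∈rest
...   | i , fi≡x = suc i , fi≡x

∣image∣≤ : {L : ℕ} (f : Fin L → Fin n) → ∣ image f ∣ ≤ L
∣image∣≤ {n} {zero} f = ≤-reflexive (∣⊥∣≡0 n)
∣image∣≤ {L = suc L} f = begin
  ∣ ⁅ f zero ⁆ ∪ image (f ∘ suc) ∣      ≤⟨ ∣p∪q∣≤∣p∣+∣q∣ ⁅ f zero ⁆ (image (f ∘ suc)) ⟩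
  ∣ ⁅ f zero ⁆ ∣ + ∣ image (f ∘ suc) ∣  ≤⟨ +-mono-≤ (≤-reflexive (∣⁅x⁆∣≡1 (f zero))) (∣image∣≤ (f ∘ suc)) ⟩
  suc L                                 ∎
  where open ≤-Reasoning

injective⇒∣image∣≡ : {L : ℕ} (f : Fin L → Fin n) → Injective _≡_ _≡_ f → ∣ image f ∣ ≡ L
injective⇒∣image∣≡ {n} {zero} f _ = ∣⊥∣≡0 n
injective⇒∣image∣≡ {L = suc L} f f-inj = trans (x∉p⇒∣⁅x⁆∪p∣≡1+∣p∣ _ f0∉rest)
  (cong suc (injective⇒∣image∣≡ (f ∘ suc) (Fin.suc-injective ∘ f-inj)))
  where
  f0∉rest : f zero ∉ image (f ∘ suc)
  f0∉rest f0∈rest with ∈-image⁻ (f ∘ suc) f0∈rest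
  ... | i , fi≡f0 with f-inj fi≡f0
  ... | ()

Edge : Graph n → Set
Edge G = Fin (length G)

Inside : Subset n → Fin n × Fin n → Set
Inside X (u , v) = u ∈ X × v ∈ X

Meets : Subset n → Fin n × Fin n → Set
Meets S (u , v) = u ∈ S ⊎ v ∈ S

inside? : (X : Subset n) (e : Fin n × Fin n) → Dec (Inside X e)
inside? X (u , v) = u ∈? X ×-dec v ∈? X

meets? : (S : Subset n) (e : Fin n × Fin n) → Dec (Meets S e)
meets? S (u , v) = u ∈? S ⊎-dec v ∈? S

insideEdges : Subset n → (G : Graph n) → Subset (length G)
insideEdges X [] = []
insideEdges X ((u , v) ∷ G) = (lookup X u ∧ lookup X v) ∷ insideEdges X G

∣insideEdges∣≡spanned : (X : Subset n) (G : Graph n) → ∣ insideEdges X G ∣ ≡ spanned X G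
∣insideEdges∣≡spanned X [] = refl
∣insideEdges∣≡spanned X ((u , v) ∷ G) with lookup X u ∧ lookup X v
... | true = cong suc (∣insideEdges∣≡spanned X G)
... | false = ∣insideEdges∣≡spanned X G

∈-insideEdges⁻ : {X : Subset n} (G : Graph n) {e : Edge G} → e ∈ insideEdges X G → Inside X (edge G e)
∈-insideEdges⁻ {X = X} ((u , v) ∷ G) {zero} e∈ =
  lookup⇒[]= u X (∧-conicalˡ _ _ uv∈) , lookup⇒[]= v X (∧-conicalʳ _ _ uv∈)
  where uv∈ = []=⇒lookup e∈
∈-insideEdges⁻ (_ ∷ G) {suc e} (there e∈) = ∈-insideEdges⁻ G e∈

∈-insideEdges⁺ : {X : Subset n} (G : Graph n) {e : Edge G} → Inside X (edge G e) → e ∈ insideEdges X G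
∈-insideEdges⁺ ((u , v) ∷ G) {zero} (u∈X , v∈X) =
  lookup⇒[]= zero _ (cong₂ _∧_ ([]=⇒lookup u∈X) ([]=⇒lookup v∈X))
∈-insideEdges⁺ (_ ∷ G) {suc e} e-inside = there (∈-insideEdges⁺ G e-inside)

spanned-++ : (X : Subset n) (G H : Graph n) → spanned X (G ++ H) ≡ spanned X G + spanned X H
spanned-++ X [] H = refl
spanned-++ X ((u , v) ∷ G) H with lookup X u ∧ lookup X v
... | true = cong suc (spanned-++ X G H)
... | false = spanned-++ X G H

spanned-concat : (X : Subset n) {c : ℕ} (Gs : List (Graph n)) →
  All (λ G → spanned X G ≤ c) Gs → spanned X (concat Gs) ≤ length Gs * c
spanned-concat X [] [] = z≤n
spanned-concat X {c} (G ∷ Gs) (G≤c ∷ Gs≤c) = begin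
  spanned X (G ++ concat Gs)              ≡⟨ spanned-++ X G (concat Gs) ⟩
  spanned X G + spanned X (concat Gs)     ≤⟨ +-mono-≤ G≤c (spanned-concat X Gs Gs≤c) ⟩
  c + length Gs * c                       ∎
  where open ≤-Reasoning

module _ (G : Graph n) (X S : Subset n) (I : Subset (length G)) where

  Peelable : Set
  Peelable = ∀ e → Inside X (edge G e) → Meets S (edge G e) → e ∈ I

  Exit : Edge G → Set
  Exit f = Inside X (edge G f) × Meets S (edge G f) × f ∉ I

  peelable-or-exit : Peelable ⊎ ∃ Exit
  peelable-or-exit with Fin.any? (λ f → inside? X (edge G f) ×-dec meets? S (edge G f) ×-dec ¬? (f ∈? I))
  ... | yes exit = inj₂ exit
  ... | no ¬exit = inj₁ λ f f-inside f-meets →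
    decidable-stable (f ∈? I) (λ f∉I → ¬exit (f , f-inside , f-meets , f∉I))

  peelable? : Dec Peelable
  peelable? with peelable-or-exit
  ... | inj₁ peel = yes peel
  ... | inj₂ (f , f-inside , f-meets , f∉I) = no λ peel → f∉I (peel f f-inside f-meets)

  spanned-peel : Peelable → spanned X G ≤ spanned (X ─ S) G + ∣ I ∣
  spanned-peel peel = begin
    spanned X G                               ≡⟨ ∣insideEdges∣≡spanned X G ⟨
    ∣ insideEdges X G ∣                       ≤⟨ p⊆q⇒∣p∣≤∣q∣ split ⟩
    ∣ insideEdges (X ─ S) G ∪ I ∣             ≤⟨ ∣p∪q∣≤∣p∣+∣q∣ (insideEdges (X ─ S) G) I ⟩
    ∣ insideEdges (X ─ S) G ∣ + ∣ I ∣         ≡⟨ cong (_+ ∣ I ∣) (∣insideEdges∣≡spanned (X ─ S) G) ⟩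
    spanned (X ─ S) G + ∣ I ∣                 ∎
    where
    open ≤-Reasoning
    avoiding : ∀ e → Inside X e → ¬ Meets S e → Inside (X ─ S) e
    avoiding (u , v) (u∈X , v∈X) ¬meets =
      x∈p∧x∉q⇒x∈p─q u∈X (¬meets ∘′ inj₁) , x∈p∧x∉q⇒x∈p─q v∈X (¬meets ∘′ inj₂)
    split : ∀ {e} → e ∈ insideEdges X G → e ∈ insideEdges (X ─ S) G ∪ I
    split {e} e∈ with meets? S (edge G e)
    ... | yes e-meets = x∈p∪q⁺ (inj₂ (peel e (∈-insideEdges⁻ G e∈) e-meets))
    ... | no ¬meets = x∈p∪q⁺ (inj₁ (∈-insideEdges⁺ G (avoiding (edge G e) (∈-insideEdges⁻ G e∈) ¬meets)))

  peel-surplus : Peelable → ∣ I ∣ ≤ ∣ X ∩ S ∣ → suc ∣ X ∣ ≤ spanned X G → suc ∣ X ─ S ∣ ≤ spanned (X ─ S) G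
  peel-surplus peel I≤ surplus = +-cancelʳ-≤ ∣ I ∣ _ _ (begin
    suc ∣ X ─ S ∣ + ∣ I ∣            ≤⟨ +-monoʳ-≤ (suc ∣ X ─ S ∣) I≤ ⟩
    suc ∣ X ─ S ∣ + ∣ X ∩ S ∣        ≡⟨ cong suc (∣p∣≡∣p─q∣+∣p∩q∣ X S) ⟨
    suc ∣ X ∣                        ≤⟨ surplus ⟩
    spanned X G                      ≤⟨ spanned-peel peel ⟩
    spanned (X ─ S) G + ∣ I ∣        ∎)
    where open ≤-Reasoning

joins-endpoint : {e : Fin n × Fin n} {a b c d : Fin n} → Joins e a b → Joins e c d → c ≡ a ⊎ c ≡ b
joins-endpoint (inj₁ (refl , refl)) (inj₁ (refl , refl)) = inj₁ refl
joins-endpoint (inj₁ (refl , refl)) (inj₂ (refl , refl)) = inj₂ refl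
joins-endpoint (inj₂ (refl , refl)) (inj₁ (refl , refl)) = inj₂ refl
joins-endpoint (inj₂ (refl , refl)) (inj₂ (refl , refl)) = inj₁ refl

reach-trans : {u v w : Fin n} → Reach G u v → Reach G v w → Reach G u w
reach-trans here q = q
reach-trans (step e j p) q = step e j (reach-trans p q)

record Walk (G : Graph n) : Set where
  field
    pos   : ℕ → Fin n
    via   : ℕ → Edge G
    links : ∀ k → Joins (edge G (via k)) (pos k) (pos (suc k))
    fresh : ∀ k → via (suc k) ≢ via k

open Walk

prepend : (W : Walk G) (f : Edge G) {u : Fin n} → Joins (edge G f) u (pos W 0) → via W 0 ≢ f → Walk G
prepend {G = G} W f {u} f-links f-fresh =
  record { pos = pos′ ; via = via′ ; links = links′ ; fresh = fresh′ }
  where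
  pos′ : ℕ → _
  pos′ zero = u
  pos′ (suc k) = pos W k
  via′ : ℕ → Edge G
  via′ zero = f
  via′ (suc k) = via W k
  links′ : ∀ k → Joins (edge G (via′ k)) (pos′ k) (pos′ (suc k))
  links′ zero = f-links
  links′ (suc k) = links W k
  fresh′ : ∀ k → via′ (suc k) ≢ via′ k
  fresh′ zero = f-fresh
  fresh′ (suc k) = fresh W k

walk-reach : (W : Walk G) (a k : ℕ) → Reach G (pos W a) (pos W (k + a))
walk-reach W a zero = here
walk-reach W a (suc k) = reach-trans (walk-reach W a k) (step (via W (k + a)) (links W (k + a)) here)

Injective-below : {A : Set} → (ℕ → A) → ℕ → Set
Injective-below x j = ∀ {p q} → p < j → q < j → x p ≡ x q → p ≡ q

-- Times are written k + stem rather than stem + k, so that 0 + stem computes to stem.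
record Lasso {A : Set} (x : ℕ → A) : Set where
  field
    stem lap : ℕ
    closes   : x (suc lap + stem) ≡ x stem
    distinct : Injective-below x (suc lap + stem)

lasso : (x : ℕ → Fin n) → Lasso x
lasso {n} x = search (suc n) 0 (+-identityʳ (suc n)) (λ ())
  where
  found : ∀ {i j} → i < j → x j ≡ x i → Injective-below x j → Lasso x
  found {i} {j} i<j xj≡xi inj = record
    { stem = i
    ; lap = j ∸ suc i
    ; closes = subst (λ e → x e ≡ x i) (sym end≡j) xj≡xi
    ; distinct = subst (Injective-below x) (sym end≡j) inj
    }
    where
    end≡j : suc (j ∸ suc i) + i ≡ j
    end≡j = trans (sym (+-suc (j ∸ suc i) i)) (m∸n+n≡m i<j)
  injective-below-suc : ∀ {j} → Injective-below x j → ¬ (∃ λ i → i < j × x j ≡ x i) → Injective-below x (suc j)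
  injective-below-suc inj new p<1+j q<1+j xp≡xq
    with m≤n⇒m<n∨m≡n (s≤s⁻¹ p<1+j) | m≤n⇒m<n∨m≡n (s≤s⁻¹ q<1+j)
  ... | inj₁ p<j | inj₁ q<j = inj p<j q<j xp≡xq
  ... | inj₁ p<j | inj₂ refl = ⊥-elim (new (_ , p<j , sym xp≡xq))
  ... | inj₂ refl | inj₁ q<j = ⊥-elim (new (_ , q<j , xp≡xq))
  ... | inj₂ refl | inj₂ refl = refl
  search : ∀ d j → d + j ≡ suc n → Injective-below x j → Lasso x
  search zero j refl inj =
    ⊥-elim (<-irrefl refl (Fin.injective⇒≤ (Fin.toℕ-injective ∘ inj (Fin.toℕ<n _) (Fin.toℕ<n _))))
  search (suc d) j d+j≡ inj with anyUpTo? (λ i → x j Fin.≟ x i) j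
  ... | yes (i , i<j , xj≡xi) = found i<j xj≡xi inj
  ... | no new = search d (suc j) (trans (+-suc d j) d+j≡) (injective-below-suc inj new)

module LassoCycle (W : Walk G) (L : Lasso (pos W)) where
  open Lasso L

  end : ℕ
  end = suc lap + stem

  loop-bound : (k : Fin (suc lap)) → toℕ k + stem < end
  loop-bound k = +-monoˡ-< stem (Fin.toℕ<n k)

  edges-distinct : ∀ {p q} → p < q → q < end → via W p ≢ via W q
  edges-distinct {p} {q} p<q q<end vp≡vq
    with joins-endpoint (links W p) (subst (λ e → Joins (edge G e) _ _) (sym vp≡vq) (links W q))
  ... | inj₁ xq≡xp = <-irrefl (sym (distinct q<end (<-trans p<q q<end) xq≡xp)) p<q
  ... | inj₂ xq≡xp+1 with distinct q<end (≤-<-trans p<q q<end) xq≡xp+1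
  ...   | refl = fresh W p (sym vp≡vq)

  cycle : Cycle G
  cycle = record
    { m = lap
    ; vs = λ k → pos W (toℕ k + stem)
    ; es = λ k → via W (toℕ k + stem)
    ; closed = trans (cong (λ i → pos W (i + stem)) (Fin.toℕ-fromℕ (suc lap))) closes
    ; vs-inj = λ i j eq → Fin.inject₁-injective (Fin.toℕ-injective (+-cancelʳ-≡ stem _ _
        (distinct (+-monoˡ-< stem (Fin.inject₁ℕ< i)) (+-monoˡ-< stem (Fin.inject₁ℕ< j)) eq)))
    ; es-inj = es-inj′
    ; joins = λ k → subst
        (λ i → Joins (edge G (via W (toℕ k + stem))) (pos W (i + stem)) (pos W (suc (toℕ k + stem))))
        (sym (Fin.toℕ-inject₁ k)) (links W (toℕ k + stem))
    }
    where
    es-inj′ : ∀ i j → via W (toℕ i + stem) ≡ via W (toℕ j + stem) → i ≡ j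
    es-inj′ i j eq with <-cmp (toℕ i) (toℕ j)
    ... | tri< i<j _ _ = ⊥-elim (edges-distinct (+-monoˡ-< stem i<j) (loop-bound j) eq)
    ... | tri≈ _ i≡j _ = Fin.toℕ-injective i≡j
    ... | tri> _ _ j<i = ⊥-elim (edges-distinct (+-monoˡ-< stem j<i) (loop-bound i) (sym eq))

  reach-loop : Reach G (pos W 0) (vs cycle zero)
  reach-loop = subst (Reach G (pos W 0) ∘ pos W) (+-identityʳ stem) (walk-reach W 0 stem)

  reach-around : ∀ k → Reach G (vs cycle zero) (vs cycle k)
  reach-around k = walk-reach W stem (toℕ k)

  loop-endpoint : ∀ {k u w} → Joins (edge G (es cycle k)) u w → ∃ λ q → stem ≤ q × q < end × pos W q ≡ u
  loop-endpoint {k} u-w with joins-endpoint (links W (toℕ k + stem)) u-w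
  ... | inj₁ u≡xk = toℕ k + stem , m≤n+m stem (toℕ k) , loop-bound k , sym u≡xk
  ... | inj₂ u≡xk+1 with m≤n⇒m<n∨m≡n (s≤s⁻¹ (Fin.toℕ<n k))
  ...   | inj₁ k<lap =
    suc (toℕ k + stem) , m≤n+m stem (suc (toℕ k)) , s≤s (+-monoˡ-< stem k<lap) , sym u≡xk+1
  ...   | inj₂ k≡lap = stem , ≤-refl , s≤s (m≤n+m stem lap) ,
    trans (sym closes) (trans (cong (λ i → pos W (suc i + stem)) (sym k≡lap)) (sym u≡xk+1))

open LassoCycle using (cycle)

meets-joins : {S : Subset n} (e : Fin n × Fin n) → Meets S e → ∃₂ λ u w → u ∈ S × Joins e u w
meets-joins (a , b) (inj₁ a∈S) = a , b , a∈S , inj₁ (refl , refl)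
meets-joins (a , b) (inj₂ b∈S) = b , a , b∈S , inj₂ (refl , refl)

joins-inside : {X : Subset n} {e : Fin n × Fin n} {u w : Fin n} → Inside X e → Joins e u w → w ∈ X
joins-inside (_ , b∈X) (inj₁ (refl , refl)) = b∈X
joins-inside (a∈X , _) (inj₂ (refl , refl)) = a∈X

lasso-leaving-cycle-is-new : (C : Cycle G) (t : Fin (suc (m C))) (W : Walk G) (L : Lasso (pos W)) →
  pos W 0 ≡ vs C (inject₁ t) → ¬ InCycle C (via W 0) → ¬ SameCycle C (cycle W L)
-- The edge of C at the start vertex lies on the loop, hence so does the start vertex; as
-- the walk is injective up to the end of the loop, the stem is empty and the first edge of
-- the walk is an edge of the loop.
lasso-leaving-cycle-is-new {G = G} C t W L start-on-C first∉C same =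
  first∉C (proj₂ (same (via W 0)) (zero , cong (via W) stem≡0))
  where
  open Lasso L
  open LassoCycle W L using (end; loop-endpoint)
  shared : InCycle (cycle W L) (es C t)
  shared = proj₁ (same (es C t)) (t , refl)
  start-on-loop : ∃ λ q → stem ≤ q × q < end × pos W q ≡ vs C (inject₁ t)
  start-on-loop = loop-endpoint (subst (λ e → Joins (edge G e) _ _) (sym (proj₂ shared)) (joins C t))
  stem≡0 : stem ≡ 0
  stem≡0 with start-on-loop
  ... | q , stem≤q , q<end , xq≡start
    with distinct q<end (≤-<-trans z≤n q<end) (trans xq≡start (sym start-on-C))
  ...   | refl = n≤0⇒n≡0 stem≤q

MinDegree₂ : (G : Graph n) → Subset n → Set
MinDegree₂ G X = ∀ {v} → v ∈ X → (e : Edge G) → ∃ (Exit G X ⁅ v ⁆ ⁅ e ⁆)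

minDegree₂-or-peelable : (G : Graph n) (X : Subset n) →
  MinDegree₂ G X ⊎ ∃₂ λ v e → v ∈ X × Peelable G X ⁅ v ⁆ ⁅ e ⁆
minDegree₂-or-peelable G X with Fin.any? (λ v → v ∈? X ×-dec Fin.any? (λ e → peelable? G X ⁅ v ⁆ ⁅ e ⁆))
... | yes (v , v∈X , e , peel) = inj₂ (v , e , v∈X , peel)
... | no ¬peel = inj₁ λ {v} v∈X e →
  [ (λ peel → ⊥-elim (¬peel (v , v∈X , e , peel))) , id ]′ (peelable-or-exit G X ⁅ v ⁆ ⁅ e ⁆)

module DegreeWalk {X : Subset n} (deg : MinDegree₂ G X) where

  record Position : Set where
    constructor at
    field
      vertex   : Fin n
      vertex∈X : vertex ∈ X
      arrival  : Edge G

  open Position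

  depart : ∀ {v} → v ∈ X → (e : Edge G) → ∃ λ f → f ≢ e × ∃ λ w → w ∈ X × Joins (edge G f) v w
  depart v∈X e with deg v∈X e
  ... | f , f-inside , f-meets , f∉⁅e⁆ with meets-joins (edge G f) f-meets
  ...   | u , w , u∈⁅v⁆ , u-w =
    f , (λ f≡e → f∉⁅e⁆ (subst (_∈ ⁅ e ⁆) (sym f≡e) (x∈⁅x⁆ e))) , w , joins-inside f-inside u-w ,
    subst (λ u → Joins (edge G f) u w) (x∈⁅y⁆⇒x≡y _ u∈⁅v⁆) u-w

  next : Position → Position
  next p = let (f , _ , w , w∈X , _) = depart (vertex∈X p) (arrival p) in at w w∈X f

  next-departs : ∀ p → arrival (next p) ≢ arrival p
  next-departs p = proj₁ (proj₂ (depart (vertex∈X p) (arrival p)))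

  next-links : ∀ p → Joins (edge G (arrival (next p))) (vertex p) (vertex (next p))
  next-links p = proj₂ (proj₂ (proj₂ (proj₂ (depart (vertex∈X p) (arrival p)))))

  positions : Position → ℕ → Position
  positions p zero = p
  positions p (suc k) = next (positions p k)

  walkFrom : Position → Walk G
  walkFrom p = record
    { pos = λ k → vertex (positions p k)
    ; via = λ k → arrival (positions p (suc k))
    ; links = next-links ∘ positions p
    ; fresh = next-departs ∘ positions p ∘ suc
    }

  walkFrom-inside : ∀ p k → pos (walkFrom p) k ∈ X
  walkFrom-inside p k = vertex∈X (positions p k)

module MinimalSurplus {G : Graph n} (pf : Pseudoforest G) (X : Subset n)
  (smaller : ∀ {Y} → ∣ Y ∣ < ∣ X ∣ → spanned Y G ≤ ∣ Y ∣) (surplus : suc ∣ X ∣ ≤ spanned X G) where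

  unpeelable : ∀ {S I} → Peelable G X S I → ∣ I ∣ ≤ ∣ X ∩ S ∣ → Nonempty (X ∩ S) → ⊥
  unpeelable {S} {I} peel I≤X∩S X∩S≢∅ =
    ≤⇒≯ (smaller (p∩q≢∅⇒∣p─q∣<∣p∣ X S X∩S≢∅)) (peel-surplus G X S I peel I≤X∩S surplus)

  minDegree₂ : MinDegree₂ G X
  minDegree₂ with minDegree₂-or-peelable G X
  ... | inj₁ deg = deg
  ... | inj₂ (v , e , v∈X , peel) =
    ⊥-elim (unpeelable peel (subst (_≤ ∣ X ∩ ⁅ v ⁆ ∣) (sym (∣⁅x⁆∣≡1 e)) (x∈p⇒0<∣p∣ v∈X∩⁅v⁆)) (v , v∈X∩⁅v⁆))
    where v∈X∩⁅v⁆ = x∈p∩q⁺ (v∈X , x∈⁅x⁆ v)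

  open DegreeWalk {G = G} minDegree₂

  start : Position
  start with 0<∣p∣⇒nonempty (insideEdges X G)
               (subst (0 <_) (sym (∣insideEdges∣≡spanned X G)) (≤-trans (s≤s z≤n) surplus))
  ... | e , e∈ = at (proj₁ (edge G e)) (proj₁ (∈-insideEdges⁻ G e∈)) e

  W₁ : Walk G
  W₁ = walkFrom start

  L₁ : Lasso (pos W₁)
  L₁ = lasso (pos W₁)

  C : Cycle G
  C = cycle W₁ L₁

  S : Subset n
  S = image (vs C ∘ inject₁)

  I : Subset (length G)
  I = image (es C)

  S⊆X : ∀ {x} → x ∈ S → x ∈ X
  S⊆X x∈S with ∈-image⁻ (vs C ∘ inject₁) x∈S
  ... | i , refl = walkFrom-inside start (toℕ (inject₁ i) + Lasso.stem L₁)

  cycle-not-peelable : ¬ Peelable G X S I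
  cycle-not-peelable peel = unpeelable peel I≤X∩S (vs C (inject₁ zero) , x∈p∩q⁺ (S⊆X c₀∈S , c₀∈S))
    where
    c₀∈S : vs C (inject₁ zero) ∈ S
    c₀∈S = ∈-image⁺ (vs C ∘ inject₁) zero
    I≤X∩S : ∣ I ∣ ≤ ∣ X ∩ S ∣
    I≤X∩S = begin
      ∣ I ∣      ≤⟨ ∣image∣≤ (es C) ⟩
      suc (m C)  ≡⟨ injective⇒∣image∣≡ (vs C ∘ inject₁) (vs-inj C _ _) ⟨
      ∣ S ∣      ≤⟨ p⊆q⇒∣p∣≤∣q∣ (λ x∈S → x∈p∩q⁺ (S⊆X x∈S , x∈S)) ⟩
      ∣ X ∩ S ∣  ∎
      where open ≤-Reasoning

  second-cycle : (f : Edge G) (t : Fin (suc (m C))) {y : Fin n} → Inside X (edge G f) → ¬ InCycle C f →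
    Joins (edge G f) (vs C (inject₁ t)) y → ⊥
  second-cycle f t {y} f-inside f∉C c-y =
    lasso-leaving-cycle-is-new C t W₂ L₂ refl f∉C (pf C (cycle W₂ L₂) C-reaches-loop)
    where
    beyond : Position
    beyond = at y (joins-inside f-inside c-y) f
    W₂ : Walk G
    W₂ = prepend (walkFrom beyond) f c-y (next-departs beyond)
    L₂ : Lasso (pos W₂)
    L₂ = lasso (pos W₂)
    C-reaches-loop : Reach G (vs C zero) (vs (cycle W₂ L₂) zero)
    C-reaches-loop = reach-trans (LassoCycle.reach-around W₁ L₁ (inject₁ t)) (LassoCycle.reach-loop W₂ L₂)

  cycle-has-no-exit : ¬ ∃ (Exit G X S I)
  cycle-has-no-exit (f , f-inside , f-meets , f∉I) =
    let (u , y , u∈S , u-y) = meets-joins (edge G f) f-meets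
        (t , cₜ≡u) = ∈-image⁻ (vs C ∘ inject₁) u∈S
    in second-cycle f t f-inside f∉C (subst (λ u → Joins (edge G f) u y) (sym cₜ≡u) u-y)
    where
    f∉C : ¬ InCycle C f
    f∉C (i , es-i≡f) = f∉I (subst (_∈ I) es-i≡f (∈-image⁺ (es C) i))

  contradiction : ⊥
  contradiction = [ cycle-not-peelable , cycle-has-no-exit ]′ (peelable-or-exit G X S I)

pseudoforest-spanned≤ : {G : Graph n} → Pseudoforest G → (X : Subset n) → spanned X G ≤ ∣ X ∣
pseudoforest-spanned≤ {G = G} pf X = go X (<-wellFounded ∣ X ∣)
  where
  go : ∀ X → Acc _<_ ∣ X ∣ → spanned X G ≤ ∣ X ∣
  go X (acc rec) = decidable-stable (spanned X G ≤? ∣ X ∣)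
    (MinimalSurplus.contradiction pf X (λ {Y} |Y|<|X| → go Y (rec |Y|<|X|)) ∘ ≰⇒>)

loop-cycle-length : (C : Cycle G) (i : Fin (suc (m C))) → vs C (inject₁ i) ≡ vs C (suc i) → m C ≡ 0
loop-cycle-length C i loop with m≤n⇒m<n∨m≡n (s≤s⁻¹ (Fin.toℕ<n i))
... | inj₁ i<m = ⊥-elim (1+n≢n (sym (trans (cong toℕ i≡i+1) (Fin.toℕ-fromℕ< (s≤s i<m)))))
  where
  i+1 = fromℕ< (s≤s i<m)
  i≡i+1 : i ≡ i+1
  i≡i+1 = vs-inj C i i+1 (trans loop (cong (vs C)
    (Fin.toℕ-injective (sym (trans (Fin.toℕ-inject₁ i+1) (Fin.toℕ-fromℕ< (s≤s i<m)))))))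
... | inj₂ i≡m = trans (sym i≡m) (cong toℕ i≡0)
  where
  i≡0 : i ≡ zero
  i≡0 = vs-inj C i zero (trans loop (trans (cong (vs C)
    (Fin.toℕ-injective (trans (cong suc i≡m) (sym (Fin.toℕ-fromℕ (suc (m C))))))) (closed C)))

lower-cycle : {x : Fin n × Fin n} (C : Cycle (x ∷ G)) → (∀ i → es C i ≢ zero) → Cycle G
lower-cycle {G = G} {x = x} C avoids = record
  { m = m C
  ; vs = vs C
  ; es = es′
  ; closed = closed C
  ; vs-inj = vs-inj C
  ; es-inj = λ i j eq → es-inj C i j (trans (sym (lift i)) (trans (cong suc eq) (lift j)))
  ; joins = λ i → subst (λ e → Joins (edge (x ∷ G) e) _ _) (sym (lift i)) (joins C i)
  }
  where
  es′ : Fin (suc (m C)) → Edge G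
  es′ i = punchOut (avoids i ∘ sym)
  lift : ∀ i → suc (es′ i) ≡ es C i
  lift i = Fin.punchIn-punchOut (avoids i ∘ sym)

forest+loop-pseudoforest : {F : Graph n} (v : Fin n) → Forest F → Pseudoforest ((v , v) ∷ F)
forest+loop-pseudoforest {F = F} v forest C D _ e = transfer C D , transfer D C
  where
  loop-ends : ∀ {a b} → Joins (v , v) a b → a ≡ b
  loop-ends (inj₁ (v≡a , v≡b)) = trans (sym v≡a) v≡b
  loop-ends (inj₂ (v≡b , v≡a)) = trans (sym v≡a) v≡b
  only-loop : (C : Cycle ((v , v) ∷ F)) → ∀ j → es C j ≡ zero
  only-loop C j with Fin.any? (λ i → es C i Fin.≟ zero)
  ... | no avoids = ⊥-elim (forest (lower-cycle C (λ i esᵢ≡0 → avoids (i , esᵢ≡0))))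
  ... | yes (i , esᵢ≡0) = trans (cong (es C) (Fin.toℕ-injective (trans (at-0 j) (sym (at-0 i))))) esᵢ≡0
    where
    m≡0 : m C ≡ 0
    m≡0 = loop-cycle-length C i (loop-ends (subst (λ e → Joins (edge ((v , v) ∷ F) e) _ _) esᵢ≡0 (joins C i)))
    at-0 : ∀ k → toℕ k ≡ 0
    at-0 k = n≤0⇒n≡0 (subst (toℕ k ≤_) m≡0 (s≤s⁻¹ (Fin.toℕ<n k)))
  transfer : ∀ C D → InCycle C e → InCycle D e
  transfer C D (j , esⱼ≡e) = zero , trans (only-loop D zero) (trans (sym (only-loop C j)) esⱼ≡e)

forest-spanned≤ : {F : Graph n} → Forest F → (X : Subset n) → spanned X F ≤ ∣ X ∣ ∸ 1
forest-spanned≤ {F = F} forest X with nonempty? X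
... | yes (v , v∈X) = suc[m]≤n⇒m≤pred[n] (subst (_≤ ∣ X ∣) with-loop
        (pseudoforest-spanned≤ (forest+loop-pseudoforest v forest) X))
  where
  with-loop : spanned X ((v , v) ∷ F) ≡ suc (spanned X F)
  with-loop rewrite []=⇒lookup v∈X = refl
... | no empty = ≤-trans (pseudoforest-spanned≤ (λ C → ⊥-elim (forest C)) X)
        (≤-reflexive (trans ∣X∣≡0 (sym (cong (_∸ 1) ∣X∣≡0))))
  where
  ∣X∣≡0 : ∣ X ∣ ≡ 0
  ∣X∣≡0 = n≤0⇒n≡0 (≮⇒≥ (empty ∘ 0<∣p∣⇒nonempty X))

sparsity-count-ℓ≤k : ∀ {k ℓ} → ℓ ≤ k → ∀ y → ℓ * y + (k ∸ ℓ) * suc y ≡ k * suc y ∸ ℓ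
sparsity-count-ℓ≤k {k} {ℓ} ℓ≤k y = sym (begin
  k * suc y ∸ ℓ                        ≡⟨ cong (λ k → k * suc y ∸ ℓ) (m+[n∸m]≡n ℓ≤k) ⟨
  (ℓ + (k ∸ ℓ)) * suc y ∸ ℓ            ≡⟨ cong (_∸ ℓ) (*-distribʳ-+ (suc y) ℓ (k ∸ ℓ)) ⟩
  ℓ * suc y + (k ∸ ℓ) * suc y ∸ ℓ      ≡⟨ cong (λ z → z + (k ∸ ℓ) * suc y ∸ ℓ) (*-suc ℓ y) ⟩
  ℓ + ℓ * y + (k ∸ ℓ) * suc y ∸ ℓ      ≡⟨ cong (_∸ ℓ) (+-assoc ℓ (ℓ * y) _) ⟩
  ℓ + (ℓ * y + (k ∸ ℓ) * suc y) ∸ ℓ    ≡⟨ m+n∸m≡n ℓ _ ⟩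
  ℓ * y + (k ∸ ℓ) * suc y              ∎)
  where open ≡-Reasoning

sparsity-count-k≤ℓ : ∀ {k ℓ} → k ≤ ℓ → ℓ ≤ 2 * k → ∀ y → (2 * k ∸ ℓ) * y ≤ k * suc y ∸ ℓ
sparsity-count-k≤ℓ {k} {ℓ} _ _ zero rewrite *-zeroʳ (2 * k ∸ ℓ) = z≤n
sparsity-count-k≤ℓ {k} {ℓ} k≤ℓ ℓ≤2k (suc z) = m+n≤o⇒m≤o∸n (a * suc z) (begin
  a * suc z + ℓ     ≡⟨ cong (_+ ℓ) (*-suc a z) ⟩
  a + a * z + ℓ     ≡⟨ rearrange a (a * z) ℓ ⟩
  a * z + (a + ℓ)   ≡⟨ cong (a * z +_) (m∸n+n≡m ℓ≤2k) ⟩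
  a * z + 2 * k     ≤⟨ +-monoˡ-≤ (2 * k) (*-monoˡ-≤ z a≤k) ⟩
  k * z + 2 * k     ≡⟨ expand k z ⟩
  k * suc (suc z)   ∎)
  where
  open ≤-Reasoning
  a = 2 * k ∸ ℓ
  a≤k : a ≤ k
  a≤k = ≤-trans (∸-monoʳ-≤ (2 * k) k≤ℓ) (≤-reflexive (trans (m+n∸m≡n k (k + 0)) (+-identityʳ k)))
  rearrange : ∀ a b c → a + b + c ≡ b + (a + c)
  rearrange = solve-∀
  expand : ∀ k z → k * z + 2 * k ≡ k * suc (suc z)
  expand = solve-∀

sparsity-count : ∀ {k ℓ} → ℓ < 2 * k → ∀ x → (ℓ ⊓ (2 * k ∸ ℓ)) * (x ∸ 1) + (k ∸ ℓ) * x ≤ k * x ∸ ℓ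
sparsity-count {k} {ℓ} _ zero rewrite *-zeroʳ (ℓ ⊓ (2 * k ∸ ℓ)) | *-zeroʳ (k ∸ ℓ) = z≤n
sparsity-count {k} {ℓ} ℓ<2k (suc y) with ℓ ≤? k
... | yes ℓ≤k = begin
  (ℓ ⊓ (2 * k ∸ ℓ)) * y + (k ∸ ℓ) * suc y  ≤⟨ +-monoˡ-≤ _ (*-monoˡ-≤ y (m⊓n≤m ℓ _)) ⟩
  ℓ * y + (k ∸ ℓ) * suc y                  ≡⟨ sparsity-count-ℓ≤k ℓ≤k y ⟩
  k * suc y ∸ ℓ                            ∎
  where open ≤-Reasoning
... | no ℓ≰k = begin
  (ℓ ⊓ (2 * k ∸ ℓ)) * y + (k ∸ ℓ) * suc y  ≡⟨ cong (λ b → (ℓ ⊓ (2 * k ∸ ℓ)) * y + b * suc y) (m≤n⇒m∸n≡0 k≤ℓ) ⟩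
  (ℓ ⊓ (2 * k ∸ ℓ)) * y + 0                ≡⟨ +-identityʳ _ ⟩
  (ℓ ⊓ (2 * k ∸ ℓ)) * y                    ≤⟨ *-monoˡ-≤ y (m⊓n≤n ℓ _) ⟩
  (2 * k ∸ ℓ) * y                          ≤⟨ sparsity-count-k≤ℓ k≤ℓ (<⇒≤ ℓ<2k) y ⟩
  k * suc y ∸ ℓ                            ∎
  where
  open ≤-Reasoning
  k≤ℓ = <⇒≤ (≰⇒> ℓ≰k)

mainTheorem3 : (k ℓ : ℕ) → ℓ < 2 * k → (n : ℕ)
    → (Fs Ps : List (Graph n))
    → length Fs ≡ ℓ ⊓ (2 * k ∸ ℓ)
    → length Ps ≡ k ∸ ℓ
    → All Forest Fs
    → All Pseudoforest Ps
    → Sparse k ℓ (concat Fs ++ concat Ps)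
mainTheorem3 k ℓ ℓ<2k n Fs Ps ∣Fs∣ ∣Ps∣ forests pseudoforests X = begin
  spanned X (concat Fs ++ concat Ps)                   ≡⟨ spanned-++ X (concat Fs) (concat Ps) ⟩
  spanned X (concat Fs) + spanned X (concat Ps)        ≤⟨ +-mono-≤
    (spanned-concat X Fs (All.map (λ forest → forest-spanned≤ forest X) forests))
    (spanned-concat X Ps (All.map (λ pf → pseudoforest-spanned≤ pf X) pseudoforests)) ⟩
  length Fs * (∣ X ∣ ∸ 1) + length Ps * ∣ X ∣          ≡⟨ cong₂ (λ a b → a * (∣ X ∣ ∸ 1) + b * ∣ X ∣) ∣Fs∣ ∣Ps∣ ⟩
  (ℓ ⊓ (2 * k ∸ ℓ)) * (∣ X ∣ ∸ 1) + (k ∸ ℓ) * ∣ X ∣    ≤⟨ sparsity-count ℓ<2k ∣ X ∣ ⟩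
  k * ∣ X ∣ ∸ ℓ                                        ∎
  where open ≤-Reasoning
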